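{- For every positive integer $n$ there exists a permutation $a=(a_1,\dots,a_n)$ of $[n]=\{1,2,\dots,n\}$ such that $|S(a)| \geq \frac{1}{4}n^2$.
   Context: For a sequence $a=(a_i)_{i=1}^n$ of integers, $S(a)$ denotes the set of all distinct values of the sums $\sum_{i=u}^v a_i$ with $1\le u\le v\le n$. -}

module Defs where

open import Data.Nat using (ℕ; suc; _≟_)
open import Data.List using (List; []; _∷_; _++_; map; length; upTo; deduplicate)
open import Data.Nat.ListAction using (sum)

range1 : ℕ → List ℕ
range1 n = map suc (upTo n)

nePrefixes : List ℕ → List (List ℕ)
nePrefixes []       = []
nePrefixes (x ∷ xs) = (x ∷ []) ∷ map (x ∷_) (nePrefixes xs)

-- all nonempty contiguous blocks (a_u, ..., a_v), 1 ≤ u ≤ v ≤ n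
blocks : List ℕ → List (List ℕ)
blocks []       = []
blocks (x ∷ xs) = nePrefixes (x ∷ xs) ++ blocks xs

blockSums : List ℕ → List ℕ
blockSums a = map sum (blocks a)

cardS : List ℕ → ℕ
cardS a = length (deduplicate _≟_ (blockSums a))

-- The sequence (2M, 1, 2M-1, 2, …, M+1, M) is a list of M pairs each summing to P = 2M+1.
-- A block made of the second entry of pair s followed by k whole pairs sums to (s+1) + kP,
-- and k whole pairs followed by the first entry of the next pair sum to kP + (first entry);
-- for each k < M this gives the M - k values kP + 1, …, kP + (M-k) and the M - k values
-- kP + M + 1, …, kP + 2M - k, all inside the gap (kP, (k+1)P). These M(M+1) values are
-- distinct, so |S| ≥ M(M+1) ≥ n²/4 for n = 2M; for n = 2M+1 prepend P, a new block sum.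
module Submission where

open import Defs
open import Data.Nat using (ℕ; zero; suc; _+_; _*_; _≤_; _<_; z≤n; s≤s; _≟_)
open import Data.Nat.Properties
open import Data.Nat.ListAction using (sum)
open import Data.Nat.ListAction.Properties using (sum-++)
open import Data.Nat.Tactic.RingSolver using (solve-∀)
open import Data.List using (List; []; _∷_; _++_; _∷ʳ_; [_]; length; applyUpTo)
open import Data.List.Properties
  using (map-++; ++-assoc; ++-conicalʳ; length-++; length-removeAt′; map-upTo)
open import Data.List.Membership.Propositional using (_∈_; _∉_)
open import Data.List.Membership.Propositional.Properties
  using (∈-map⁺; ∈-++⁺ˡ; ∈-++⁺ʳ; ∈-++⁻; ∈-deduplicate⁺)
open import Data.List.Relation.Binary.Subset.Propositional using (_⊆_)
open import Data.List.Relation.Binary.Disjoint.Propositional using (Disjoint)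
open import Data.List.Relation.Binary.Permutation.Propositional
  using (_↭_; ↭-refl; prep; swap; module PermutationReasoning)
open import Data.List.Relation.Binary.Permutation.Propositional.Properties using (∷↭∷ʳ; ++⁺ʳ)
open import Data.List.Relation.Unary.Any using (here; there; index; _─_)
open import Data.List.Relation.Unary.All as All using (All; []; _∷_)
open import Data.List.Relation.Unary.All.Properties using (¬Any⇒All¬)
open import Data.List.Relation.Unary.AllPairs using ([]; _∷_)
open import Data.List.Relation.Unary.Unique.Propositional using (Unique)
import Data.List.Relation.Unary.Unique.Propositional.Properties as Unique
open import Data.Product using (Σ; _×_; ∃-syntax; _,_; proj₁; proj₂)
open import Data.Sum using (_⊎_; inj₁; inj₂)
open import Data.Empty using (⊥-elim)
open import Relation.Binary.PropositionalEquality
  using (_≡_; _≢_; refl; sym; trans; cong; cong₂; subst; subst₂; module ≡-Reasoning)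

∈-─ : ∀ {A : Set} {x v : A} {ys : List A} (x∈ys : x ∈ ys) → v ∈ ys → x ≢ v → v ∈ (ys ─ x∈ys)
∈-─ (here refl)  (here refl)  x≢v = ⊥-elim (x≢v refl)
∈-─ (here _)     (there v∈ys) _   = v∈ys
∈-─ (there _)    (here refl)  _   = here refl
∈-─ (there x∈ys) (there v∈ys) x≢v = there (∈-─ x∈ys v∈ys x≢v)

unique⊆⇒length≤ : ∀ {A : Set} {xs ys : List A} → Unique xs → xs ⊆ ys → length xs ≤ length ys
unique⊆⇒length≤ {xs = []} _ _ = z≤n
unique⊆⇒length≤ {xs = x ∷ xs} {ys} (x∉xs ∷ unique) xs⊆ys = begin
  suc (length xs)          ≤⟨ s≤s (unique⊆⇒length≤ unique xs⊆ys─x) ⟩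
  suc (length (ys ─ x∈ys)) ≡⟨ length-removeAt′ ys (index x∈ys) ⟨
  length ys                ∎
  where
  open ≤-Reasoning
  x∈ys : x ∈ ys
  x∈ys = xs⊆ys (here refl)
  xs⊆ys─x : xs ⊆ (ys ─ x∈ys)
  xs⊆ys─x v∈xs = ∈-─ x∈ys (xs⊆ys (there v∈xs)) (All.lookup x∉xs v∈xs)

unique⊆blockSums⇒length≤cardS : ∀ {xs a} → Unique xs → xs ⊆ blockSums a → length xs ≤ cardS a
unique⊆blockSums⇒length≤cardS unique xs⊆ =
  unique⊆⇒length≤ unique (λ v∈xs → ∈-deduplicate⁺ _≟_ (xs⊆ v∈xs))

nePrefix∈nePrefixes : ∀ y ys zs → y ∷ ys ∈ nePrefixes (y ∷ ys ++ zs)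
nePrefix∈nePrefixes y []        zs = here refl
nePrefix∈nePrefixes y (y′ ∷ ys) zs = there (∈-map⁺ (y ∷_) (nePrefix∈nePrefixes y′ ys zs))

infix∈blocks : ∀ xs {ys} zs → ys ≢ [] → ys ∈ blocks (xs ++ ys ++ zs)
infix∈blocks []       {[]}     zs ys≢[] = ⊥-elim (ys≢[] refl)
infix∈blocks []       {y ∷ ys} zs _     = ∈-++⁺ˡ (nePrefix∈nePrefixes y ys zs)
infix∈blocks (x ∷ xs) {ys}     zs ys≢[] =
  ∈-++⁺ʳ (nePrefixes (x ∷ xs ++ ys ++ zs)) (infix∈blocks xs zs ys≢[])

sum-infix∈blockSums : ∀ xs {ys} zs → ys ≢ [] → sum ys ∈ blockSums (xs ++ ys ++ zs)
sum-infix∈blockSums xs zs ys≢[] = ∈-map⁺ sum (infix∈blocks xs zs ys≢[])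

blockSums-∷ : ∀ x xs → blockSums xs ⊆ blockSums (x ∷ xs)
blockSums-∷ x xs v∈ rewrite map-++ sum (nePrefixes (x ∷ xs)) (blocks xs) = ∈-++⁺ʳ _ v∈

SumsTo : ℕ → ℕ × ℕ → Set
SumsTo c (b , m) = b + m ≡ c

concatPairs : List (ℕ × ℕ) → List ℕ
concatPairs []             = []
concatPairs ((b , m) ∷ ps) = b ∷ m ∷ concatPairs ps

concatPairs-++ : ∀ ps qs → concatPairs (ps ++ qs) ≡ concatPairs ps ++ concatPairs qs
concatPairs-++ []             qs = refl
concatPairs-++ ((b , m) ∷ ps) qs = cong (λ l → b ∷ m ∷ l) (concatPairs-++ ps qs)

sum-concatPairs : ∀ {c ps} → All (SumsTo c) ps → sum (concatPairs ps) ≡ length ps * c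
sum-concatPairs [] = refl
sum-concatPairs {c} {(b , m) ∷ ps} (b+m≡c ∷ sums) = begin
  b + (m + sum (concatPairs ps)) ≡⟨ +-assoc b m _ ⟨
  b + m + sum (concatPairs ps)   ≡⟨ cong₂ _+_ b+m≡c (sum-concatPairs sums) ⟩
  c + length ps * c              ∎
  where open ≡-Reasoning

snd+pairs∈blockSums : ∀ {c} us {b m} qs rs → All (SumsTo c) qs →
                      m + length qs * c ∈ blockSums (concatPairs (us ++ (b , m) ∷ qs ++ rs))
snd+pairs∈blockSums {c} us {b} {m} qs rs sums =
  subst₂ (λ v l → v ∈ blockSums l) (cong (m +_) (sum-concatPairs sums)) layout
    (sum-infix∈blockSums (concatPairs us ++ [ b ]) (concatPairs rs) (λ ()))
  where
  open ≡-Reasoning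
  layout : (concatPairs us ++ [ b ]) ++ (m ∷ concatPairs qs) ++ concatPairs rs
         ≡ concatPairs (us ++ (b , m) ∷ qs ++ rs)
  layout = begin
    (concatPairs us ++ [ b ]) ++ (m ∷ concatPairs qs) ++ concatPairs rs
      ≡⟨ ++-assoc (concatPairs us) [ b ] _ ⟩
    concatPairs us ++ b ∷ m ∷ concatPairs qs ++ concatPairs rs
      ≡⟨ cong (λ l → concatPairs us ++ b ∷ m ∷ l) (concatPairs-++ qs rs) ⟨
    concatPairs us ++ concatPairs ((b , m) ∷ qs ++ rs)
      ≡⟨ concatPairs-++ us _ ⟨
    concatPairs (us ++ (b , m) ∷ qs ++ rs) ∎

pairs+fst∈blockSums : ∀ {c} us qs {b m} rs → All (SumsTo c) qs →
                      length qs * c + b ∈ blockSums (concatPairs (us ++ qs ++ (b , m) ∷ rs))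
pairs+fst∈blockSums {c} us qs {b} {m} rs sums =
  subst₂ (λ v l → v ∈ blockSums l) value layout
    (sum-infix∈blockSums (concatPairs us) (m ∷ concatPairs rs) nonempty)
  where
  open ≡-Reasoning
  nonempty : concatPairs qs ++ [ b ] ≢ []
  nonempty eq with () ← ++-conicalʳ (concatPairs qs) [ b ] eq
  value : sum (concatPairs qs ++ [ b ]) ≡ length qs * c + b
  value = begin
    sum (concatPairs qs ++ [ b ])  ≡⟨ sum-++ (concatPairs qs) [ b ] ⟩
    sum (concatPairs qs) + (b + 0) ≡⟨ cong₂ _+_ (sum-concatPairs sums) (+-identityʳ b) ⟩
    length qs * c + b              ∎
  layout : concatPairs us ++ (concatPairs qs ++ [ b ]) ++ m ∷ concatPairs rs
         ≡ concatPairs (us ++ qs ++ (b , m) ∷ rs)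
  layout = begin
    concatPairs us ++ (concatPairs qs ++ [ b ]) ++ m ∷ concatPairs rs
      ≡⟨ cong (concatPairs us ++_) (++-assoc (concatPairs qs) [ b ] _) ⟩
    concatPairs us ++ concatPairs qs ++ b ∷ m ∷ concatPairs rs
      ≡⟨ cong (concatPairs us ++_) (concatPairs-++ qs _) ⟨
    concatPairs us ++ concatPairs (qs ++ (b , m) ∷ rs)
      ≡⟨ concatPairs-++ us _ ⟨
    concatPairs (us ++ qs ++ (b , m) ∷ rs) ∎

interval : ℕ → ℕ → List ℕ
interval a zero    = []
interval a (suc l) = a ∷ interval (suc a) l

length-interval : ∀ a l → length (interval a l) ≡ l
length-interval a zero    = refl
length-interval a (suc l) = cong suc (length-interval (suc a) l)

∈-interval⁻ : ∀ {a l v} → v ∈ interval a l → ∃[ x ] x < l × v ≡ a + x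
∈-interval⁻ {a} {suc l} (here refl) = 0 , s≤s z≤n , sym (+-identityʳ a)
∈-interval⁻ {a} {suc l} (there v∈)
  with x , x<l , refl ← ∈-interval⁻ v∈ = suc x , s≤s x<l , sym (+-suc a x)

∈-interval⇒bounds : ∀ {a l v} → v ∈ interval a l → a ≤ v × v < a + l
∈-interval⇒bounds {a} v∈ with x , x<l , refl ← ∈-interval⁻ v∈ = m≤m+n a x , +-monoʳ-< a x<l

unique-interval : ∀ a l → Unique (interval a l)
unique-interval a zero    = []
unique-interval a (suc l) =
  All.tabulate (λ v∈ → <⇒≢ (proj₁ (∈-interval⇒bounds v∈))) ∷ unique-interval (suc a) l

interval-∷ʳ : ∀ a l → interval a (suc l) ≡ interval a l ∷ʳ (a + l)
interval-∷ʳ a zero    = cong [_] (sym (+-identityʳ a))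
interval-∷ʳ a (suc l) = cong (a ∷_)
  (trans (interval-∷ʳ (suc a) l) (cong (interval (suc a) l ∷ʳ_) (sym (+-suc a l))))

interval-++ : ∀ a k l → interval a k ++ interval (a + k) l ≡ interval a (k + l)
interval-++ a zero    l = cong (λ b → interval b l) (+-identityʳ a)
interval-++ a (suc k) l = cong (a ∷_)
  (trans (cong (λ b → interval (suc a) k ++ interval b l) (+-suc a k)) (interval-++ (suc a) k l))

applyUpTo≡interval : ∀ {f a} n → (∀ i → f i ≡ a + i) → applyUpTo f n ≡ interval a n
applyUpTo≡interval {f} {a} zero    f≗ = refl
applyUpTo≡interval {f} {a} (suc n) f≗ =
  cong₂ _∷_ (trans (f≗ 0) (+-identityʳ a)) (applyUpTo≡interval n (λ i → trans (f≗ (suc i)) (+-suc a i)))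

range1≡interval : ∀ n → range1 n ≡ interval 1 n
range1≡interval n = trans (map-upTo suc n) (applyUpTo≡interval n (λ _ → refl))

zigzagPairs : (lo hi r : ℕ) → List (ℕ × ℕ)
zigzagPairs lo hi zero    = []
zigzagPairs lo hi (suc r) = (hi + r , lo) ∷ zigzagPairs (suc lo) hi r

length-zigzagPairs : ∀ lo hi r → length (zigzagPairs lo hi r) ≡ r
length-zigzagPairs lo hi zero    = refl
length-zigzagPairs lo hi (suc r) = cong suc (length-zigzagPairs (suc lo) hi r)

zigzagPairs-++ : ∀ lo hi k e →
                 zigzagPairs lo hi (k + e) ≡ zigzagPairs lo (hi + e) k ++ zigzagPairs (k + lo) hi e
zigzagPairs-++ lo hi zero    e = refl
zigzagPairs-++ lo hi (suc k) e = cong₂ _∷_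
  (cong (_, lo) (trans (cong (hi +_) (+-comm k e)) (sym (+-assoc hi e k))))
  (trans (zigzagPairs-++ (suc lo) hi k e)
         (cong (λ l → zigzagPairs (suc lo) (hi + e) k ++ zigzagPairs l hi e) (+-suc k lo)))

zigzagPairs-++₃ : ∀ lo hi s k e → zigzagPairs lo hi (s + (k + e))
                ≡ zigzagPairs lo (hi + (k + e)) s
                  ++ zigzagPairs (s + lo) (hi + e) k
                  ++ zigzagPairs (k + (s + lo)) hi e
zigzagPairs-++₃ lo hi s k e = trans (zigzagPairs-++ lo hi s (k + e))
  (cong (zigzagPairs lo (hi + (k + e)) s ++_) (zigzagPairs-++ (s + lo) hi k e))

zigzagPairs-sumsTo : ∀ {c} lo hi r → lo + (hi + r) ≡ suc c → All (SumsTo c) (zigzagPairs lo hi r)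
zigzagPairs-sumsTo lo hi zero    _  = []
zigzagPairs-sumsTo {c} lo hi (suc r) eq =
  trans (+-comm (hi + r) lo) sum≡c ∷ zigzagPairs-sumsTo (suc lo) hi r (cong suc sum≡c)
  where
  sum≡c : lo + (hi + r) ≡ c
  sum≡c = suc-injective (trans (sym (trans (cong (lo +_) (+-suc hi r)) (+-suc lo (hi + r)))) eq)

concatPairs-zigzagPairs-↭ : ∀ lo hi r → concatPairs (zigzagPairs lo hi r) ↭ interval lo r ++ interval hi r
concatPairs-zigzagPairs-↭ lo hi zero    = ↭-refl
concatPairs-zigzagPairs-↭ lo hi (suc r) = begin
  hi + r ∷ lo ∷ concatPairs (zigzagPairs (suc lo) hi r)
    ↭⟨ swap (hi + r) lo (concatPairs-zigzagPairs-↭ (suc lo) hi r) ⟩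
  lo ∷ hi + r ∷ interval (suc lo) r ++ interval hi r
    ↭⟨ prep lo (∷↭∷ʳ (hi + r) _) ⟩
  lo ∷ (interval (suc lo) r ++ interval hi r) ∷ʳ (hi + r)
    ≡⟨ cong (lo ∷_) (++-assoc (interval (suc lo) r) (interval hi r) _) ⟩
  lo ∷ interval (suc lo) r ++ interval hi r ∷ʳ (hi + r)
    ≡⟨ cong (λ l → lo ∷ interval (suc lo) r ++ l) (interval-∷ʳ hi r) ⟨
  lo ∷ interval (suc lo) r ++ interval hi (suc r) ∎
  where open PermutationReasoning

pairSum : ℕ → ℕ
pairSum M = suc (M + M)

zigzag : ℕ → List ℕ
zigzag M = concatPairs (zigzagPairs 1 (suc M) M)

zigzag-↭ : ∀ M → zigzag M ↭ range1 (M + M)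
zigzag-↭ M = subst (zigzag M ↭_) (trans (interval-++ 1 M M) (sym (range1≡interval (M + M))))
  (concatPairs-zigzagPairs-↭ 1 (suc M) M)

pairSum∷zigzag-↭ : ∀ M → pairSum M ∷ zigzag M ↭ range1 (pairSum M)
pairSum∷zigzag-↭ M = begin
  pairSum M ∷ zigzag M                ↭⟨ ∷↭∷ʳ (pairSum M) (zigzag M) ⟩
  zigzag M ∷ʳ pairSum M               ↭⟨ ++⁺ʳ [ pairSum M ] (zigzag-↭ M) ⟩
  range1 (M + M) ∷ʳ pairSum M         ≡⟨ cong (_∷ʳ pairSum M) (range1≡interval (M + M)) ⟩
  interval 1 (M + M) ∷ʳ pairSum M     ≡⟨ interval-∷ʳ 1 (M + M) ⟨
  interval 1 (pairSum M)              ≡⟨ range1≡interval (pairSum M) ⟨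
  range1 (pairSum M)                  ∎
  where open PermutationReasoning

-- Pair number s of zigzagPairs 1 (suc M) M is (2M - s , s + 1).
lowBlock∈blockSums : ∀ {M} s k e → s + (suc k + e) ≡ M →
                     suc (k * pairSum M) + s ∈ blockSums (zigzag M)
lowBlock∈blockSums s k e refl =
  subst₂ (λ v ps → v ∈ blockSums (concatPairs ps)) value (sym (zigzagPairs-++₃ 1 (suc M) s (suc k) e))
    (snd+pairs∈blockSums us qs rs (zigzagPairs-sumsTo (suc (s + 1)) (suc M + e) k (arithmetic s k e)))
  where
  open ≡-Reasoning
  M : ℕ
  M = s + (suc k + e)
  us qs rs : List (ℕ × ℕ)
  us = zigzagPairs 1 (suc M + (suc k + e)) s
  qs = zigzagPairs (suc (s + 1)) (suc M + e) k
  rs = zigzagPairs (suc k + (s + 1)) (suc M) e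
  arithmetic : ∀ s k e → let M = s + (suc k + e) in suc (s + 1) + (suc M + e + k) ≡ suc (suc (M + M))
  arithmetic = solve-∀
  value : s + 1 + length qs * pairSum M ≡ suc (k * pairSum M) + s
  value = begin
    s + 1 + length qs * pairSum M ≡⟨ cong (λ n → s + 1 + n * pairSum M) (length-zigzagPairs _ _ k) ⟩
    s + 1 + k * pairSum M         ≡⟨ cong (_+ k * pairSum M) (+-comm s 1) ⟩
    suc (s + k * pairSum M)       ≡⟨ cong suc (+-comm s _) ⟩
    suc (k * pairSum M) + s       ∎

highBlock∈blockSums : ∀ {M} s k e → s + (k + suc e) ≡ M →
                      k * pairSum M + suc M + e ∈ blockSums (zigzag M)
highBlock∈blockSums s k e refl =
  subst₂ (λ v ps → v ∈ blockSums (concatPairs ps)) value (sym (zigzagPairs-++₃ 1 (suc M) s k (suc e)))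
    (pairs+fst∈blockSums us qs rs (zigzagPairs-sumsTo (s + 1) (suc M + suc e) k (arithmetic s k e)))
  where
  open ≡-Reasoning
  M : ℕ
  M = s + (k + suc e)
  us qs rs : List (ℕ × ℕ)
  us = zigzagPairs 1 (suc M + (k + suc e)) s
  qs = zigzagPairs (s + 1) (suc M + suc e) k
  rs = zigzagPairs (suc (k + (s + 1))) (suc M) e
  arithmetic : ∀ s k e → let M = s + (k + suc e) in s + 1 + (suc M + suc e + k) ≡ suc (suc (M + M))
  arithmetic = solve-∀
  value : length qs * pairSum M + (suc M + e) ≡ k * pairSum M + suc M + e
  value = begin
    length qs * pairSum M + (suc M + e)
      ≡⟨ cong (λ n → n * pairSum M + (suc M + e)) (length-zigzagPairs _ _ k) ⟩
    k * pairSum M + (suc M + e)         ≡⟨ +-assoc (k * pairSum M) (suc M) e ⟨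
    k * pairSum M + suc M + e           ∎

level : (M k w : ℕ) → List ℕ
level M k w = interval (suc (k * pairSum M)) w ++ interval (k * pairSum M + suc M) w

levels : (M k r : ℕ) → List ℕ
levels M k zero    = []
levels M k (suc r) = level M k (suc r) ++ levels M (suc k) r

length-levels : ∀ M k r → length (levels M k r) ≡ r * suc r
length-levels M k zero    = refl
length-levels M k (suc r) = begin
  length (level M k (suc r) ++ levels M (suc k) r)
    ≡⟨ length-++ (level M k (suc r)) ⟩
  length (level M k (suc r)) + length (levels M (suc k) r)
    ≡⟨ cong₂ _+_ (trans (length-++ (interval (suc (k * pairSum M)) (suc r)))
                        (cong₂ _+_ (length-interval _ (suc r)) (length-interval _ (suc r))))
                 (length-levels M (suc k) r) ⟩
  (suc r + suc r) + r * suc r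
    ≡⟨ arithmetic r ⟩
  suc r * suc (suc r) ∎
  where
  open ≡-Reasoning
  arithmetic : ∀ r → (suc r + suc r) + r * suc r ≡ suc r * suc (suc r)
  arithmetic = solve-∀

level-lower : ∀ {M k w v} → v ∈ level M k w → k * pairSum M < v
level-lower {M} {k} {w} v∈ with ∈-++⁻ (interval (suc (k * pairSum M)) w) v∈
... | inj₁ v∈low  = proj₁ (∈-interval⇒bounds v∈low)
... | inj₂ v∈high = <-≤-trans (m<m+n (k * pairSum M) (s≤s z≤n)) (proj₁ (∈-interval⇒bounds v∈high))

lowHalf-upper : ∀ {M k w v} → w ≤ M → v ∈ interval (suc (k * pairSum M)) w → v < k * pairSum M + suc M
lowHalf-upper {M} {k} {w} {v} w≤M v∈ = begin-strict
  v                        <⟨ proj₂ (∈-interval⇒bounds v∈) ⟩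
  suc (k * pairSum M + w)  ≤⟨ s≤s (+-monoʳ-≤ (k * pairSum M) w≤M) ⟩
  suc (k * pairSum M + M)  ≡⟨ +-suc (k * pairSum M) M ⟨
  k * pairSum M + suc M    ∎
  where open ≤-Reasoning

level-upper : ∀ {M k w v} → w ≤ M → v ∈ level M k w → v < suc k * pairSum M
level-upper {M} {k} {w} w≤M v∈ with ∈-++⁻ (interval (suc (k * pairSum M)) w) v∈
... | inj₁ v∈low  = <-≤-trans (lowHalf-upper {M} {k} w≤M v∈low) (begin
  k * pairSum M + suc M       ≤⟨ +-monoʳ-≤ (k * pairSum M) (s≤s (m≤n+m M M)) ⟩
  k * pairSum M + pairSum M   ≡⟨ +-comm (k * pairSum M) _ ⟩
  suc k * pairSum M           ∎)
  where open ≤-Reasoning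
... | inj₂ v∈high = <-≤-trans (proj₂ (∈-interval⇒bounds v∈high)) (begin
  k * pairSum M + suc M + w   ≤⟨ +-monoʳ-≤ (k * pairSum M + suc M) w≤M ⟩
  k * pairSum M + suc M + M   ≡⟨ +-assoc (k * pairSum M) (suc M) M ⟩
  k * pairSum M + pairSum M   ≡⟨ +-comm (k * pairSum M) _ ⟩
  suc k * pairSum M           ∎)
  where open ≤-Reasoning

levels-lower : ∀ {M k r v} → v ∈ levels M k r → k * pairSum M < v
levels-lower {M} {k} {suc r} v∈ with ∈-++⁻ (level M k (suc r)) v∈
... | inj₁ v∈level = level-lower {M} {k} {suc r} v∈level
... | inj₂ v∈rest  = ≤-<-trans (m≤n+m (k * pairSum M) (pairSum M)) (levels-lower {M} {suc k} {r} v∈rest)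

separated⇒disjoint : ∀ {xs ys} b → (∀ {v} → v ∈ xs → v < b) → (∀ {v} → v ∈ ys → b ≤ v) →
                     Disjoint xs ys
separated⇒disjoint b below above (v∈xs , v∈ys) = <⇒≱ (below v∈xs) (above v∈ys)

unique-level : ∀ {M} k {w} → w ≤ M → Unique (level M k w)
unique-level {M} k {w} w≤M = Unique.++⁺ (unique-interval _ w) (unique-interval _ w)
  (separated⇒disjoint (k * pairSum M + suc M) (lowHalf-upper {M} {k} w≤M)
                      (λ v∈ → proj₁ (∈-interval⇒bounds v∈)))

unique-levels : ∀ {M} k {r} → r ≤ M → Unique (levels M k r)
unique-levels k {zero}  _   = []
unique-levels {M} k {suc r} r≤M =
  Unique.++⁺ (unique-level k r≤M) (unique-levels (suc k) (≤-trans (n≤1+n r) r≤M))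
  (separated⇒disjoint _ (level-upper {M} {k} r≤M) (λ v∈ → <⇒≤ (levels-lower {M} {suc k} {r} v∈)))

pairSum∉levels : ∀ M → pairSum M ∉ levels M 0 M
pairSum∉levels zero    ()
pairSum∉levels (suc r) P∈ with ∈-++⁻ (level (suc r) 0 (suc r)) P∈
... | inj₁ P∈level = <-irrefl (sym (+-identityʳ _)) (level-upper {suc r} {0} ≤-refl P∈level)
... | inj₂ P∈rest  = <-irrefl (+-identityʳ _) (levels-lower {suc r} {1} {r} P∈rest)

level⊆blockSums : ∀ {M} k w → k + w ≡ M → level M k w ⊆ blockSums (zigzag M)
level⊆blockSums {M} k w k+w≡M v∈ with ∈-++⁻ (interval (suc (k * pairSum M)) w) v∈
... | inj₁ v∈low
  with x , x<w , refl ← ∈-interval⁻ v∈low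
  with e , refl ← m≤n⇒∃[o]m+o≡n x<w
  = lowBlock∈blockSums x k e (trans (arithmetic x k e) k+w≡M)
  where
  arithmetic : ∀ x k e → x + (suc k + e) ≡ k + (suc x + e)
  arithmetic = solve-∀
... | inj₂ v∈high
  with x , x<w , refl ← ∈-interval⁻ v∈high
  with e , refl ← m≤n⇒∃[o]m+o≡n x<w
  = highBlock∈blockSums e k x (trans (arithmetic x k e) k+w≡M)
  where
  arithmetic : ∀ x k e → e + (k + suc x) ≡ k + (suc x + e)
  arithmetic = solve-∀

levels⊆blockSums : ∀ {M} k r → k + r ≡ M → levels M k r ⊆ blockSums (zigzag M)
levels⊆blockSums {M} k (suc r) k+r≡M v∈ with ∈-++⁻ (level M k (suc r)) v∈
... | inj₁ v∈level = level⊆blockSums k (suc r) k+r≡M v∈level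
... | inj₂ v∈rest  = levels⊆blockSums (suc k) r (trans (sym (+-suc k r)) k+r≡M) v∈rest

zigzag-cardS : ∀ M → M * suc M ≤ cardS (zigzag M)
zigzag-cardS M = subst (_≤ cardS (zigzag M)) (length-levels M 0 M)
  (unique⊆blockSums⇒length≤cardS {a = zigzag M}
    (unique-levels {M} 0 ≤-refl) (levels⊆blockSums {M} 0 M refl))

pairSum∷zigzag-cardS : ∀ M → suc (M * suc M) ≤ cardS (pairSum M ∷ zigzag M)
pairSum∷zigzag-cardS M = subst (_≤ cardS (pairSum M ∷ zigzag M)) (cong suc (length-levels M 0 M))
  (unique⊆blockSums⇒length≤cardS {a = pairSum M ∷ zigzag M}
    (¬Any⇒All¬ (levels M 0 M) (pairSum∉levels M) ∷ unique-levels {M} 0 ≤-refl)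
    λ { (here refl) → subst (_∈ blockSums (pairSum M ∷ zigzag M)) (+-identityʳ (pairSum M))
                        (sum-infix∈blockSums [] {[ pairSum M ]} (zigzag M) (λ ()))
      ; (there v∈)  → blockSums-∷ (pairSum M) (zigzag M) (levels⊆blockSums {M} 0 M refl v∈) })

even-or-odd : ∀ n → ∃[ M ] (n ≡ M + M ⊎ n ≡ suc (M + M))
even-or-odd zero = 0 , inj₁ refl
even-or-odd (suc n) with even-or-odd n
... | M , inj₁ refl = M , inj₂ refl
... | M , inj₂ refl = suc M , inj₁ (cong suc (sym (+-suc M M)))

proposition1p2 : (n : ℕ) → 1 ≤ n →
    Σ (List ℕ) (λ a → (a ↭ range1 n) × (n * n ≤ 4 * cardS a))
proposition1p2 n _ with even-or-odd n
... | M , inj₁ refl = zigzag M , zigzag-↭ M , (begin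
  (M + M) * (M + M)                 ≤⟨ m≤m+n _ (4 * M) ⟩
  (M + M) * (M + M) + 4 * M         ≡⟨ even-square M ⟩
  4 * (M * suc M)                   ≤⟨ *-monoʳ-≤ 4 (zigzag-cardS M) ⟩
  4 * cardS (zigzag M)              ∎)
  where
  open ≤-Reasoning
  even-square : ∀ M → (M + M) * (M + M) + 4 * M ≡ 4 * (M * suc M)
  even-square = solve-∀
... | M , inj₂ refl = pairSum M ∷ zigzag M , pairSum∷zigzag-↭ M , (begin
  pairSum M * pairSum M             ≤⟨ m≤m+n _ 3 ⟩
  pairSum M * pairSum M + 3         ≡⟨ odd-square M ⟩
  4 * suc (M * suc M)               ≤⟨ *-monoʳ-≤ 4 (pairSum∷zigzag-cardS M) ⟩
  4 * cardS (pairSum M ∷ zigzag M)  ∎)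
  where
  open ≤-Reasoning
  odd-square : ∀ M → suc (M + M) * suc (M + M) + 3 ≡ 4 * suc (M * suc M)
  odd-square = solve-∀
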